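{- Let $\phi$ be a pfo-formula such that $[\phi]_{ACO}$ is a normal form of the system $Y=(\mathrm{PFO},\to_{\{P\downarrow,S\downarrow,M\}})/\stackrel{*}{\leftrightarrow}_{ACO}$. Then $[\phi]_{\mathcal{T}}$ is a normal form of the system $Y'=(\mathrm{PFO},\to_{\{S\downarrow,M\}})/\stackrel{*}{\leftrightarrow}_{\mathcal{T}}$.
   Context: All formulas are relational first-order formulas; $\wedge,\vee$ are binary. A pfo-formula is a first-order formula with no negation; $\mathrm{PFO}$ is the class of all pfo-formulas; $\mathrm{free}(\psi)$ is the set of free variables of $\psi$. Rewriting rules (applicable to any subformula occurrence; $\oplus\in\{\wedge,\vee\}$, $Q\in\{\exists,\forall\}$): $A$: $F_1\oplus(F_2\oplus F_3)\to(F_1\oplus F_2)\oplus F_3$ and its converse; $C$: $F_1\oplus F_2\to F_2\oplus F_1$; $O$: $QxQyF\to QyQxF$; $P\!\downarrow$: $\exists x(F_1\wedge F_2)\to(\exists xF_1)\wedge F_2$ and $\forall x(F_1\vee F_2)\to(\forall xF_1)\vee F_2$ whenever $x\notin\mathrm{free}(F_2)$; $P\!\uparrow$: inverse of $P\!\downarrow$; $N$: $QxF\to QyF'$ when $y\notin\mathrm{free}(F)$ and $F'$ arises from $F$ by replacing each free occurrence of $x$ by $y$; $S\!\downarrow$: $\exists x(F_1\vee F_2)\to(\exists xF_1)\vee(\exists xF_2)$ and $\forall x(F_1\wedge F_2)\to(\forall xF_1)\wedge(\forall xF_2)$; $M$: $QxF\to F$ when $x\notin\mathrm{free}(F)$.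 $\mathcal{T}=\{A,C,O,P\!\downarrow,P\!\uparrow,N\}$. For a set $\mathcal{R}$ of rules, $\to_{\mathcal{R}}$ is the union of the $\to_R$; $\stackrel{*}{\leftrightarrow}_{\mathcal{R}}$ is the reflexive-transitive closure of $\to_{\mathcal{R}}$ together with its inverse; $[\phi]_{\mathcal{R}}$ is the $\stackrel{*}{\leftrightarrow}_{\mathcal{R}}$-class of $\phi$. A system is a pair $(D,\to)$; an element $d$ is a normal form (is in normal form) if there is no $d'$ with $d\to d'$. For an equivalence relation $\equiv$ on $D$, $(D,\to)/\equiv$ is the system whose elements are the $\equiv$-classes, with $C\to C'$ iff there exist $d\in C$, $d'\in C'$ with $d\to d'$. -}

module Defs where

open import Data.Nat using (ℕ; _≟_)
open import Data.List using (List; map)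
open import Data.List.Membership.Propositional using (_∈_)
open import Data.Product using (Σ; _×_; ∃)
open import Data.Sum using (_⊎_)
open import Data.Bool using (if_then_else_)
open import Relation.Nullary using (¬_)
open import Relation.Nullary.Decidable using (⌊_⌋)
open import Relation.Binary.PropositionalEquality using (_≡_)
open import Relation.Binary.Construct.Closure.Equivalence using (EqClosure)

-- Relational first-order formulas without negation (pfo-formulas).

Var : Set
Var = ℕ

data Quant : Set where
  ex all : Quant

data Op : Set where
  and or : Op

data Formula : Set where
  atom  : ℕ → List Var → Formula
  bin   : Op → Formula → Formula → Formula
  quant : Quant → Var → Formula → Formula

data Free (x : Var) : Formula → Set where
  atomF : ∀ {R xs} → x ∈ xs → Free x (atom R xs)
  binL  : ∀ {o F G} → Free x F → Free x (bin o F G)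
  binR  : ∀ {o F G} → Free x G → Free x (bin o F G)
  quantF : ∀ {q z F} → ¬ (z ≡ x) → Free x F → Free x (quant q z F)

replaceVar : Var → Var → Var → Var
replaceVar x y v = if ⌊ v ≟ x ⌋ then y else v

-- Rename x y F F' : F' arises from F by replacing each free occurrence
-- of x by y (capture-avoiding: no replaced occurrence falls into the
-- scope of a quantifier on y).
data Rename (x y : Var) : Formula → Formula → Set where
  atomR  : ∀ {R xs} → Rename x y (atom R xs) (atom R (map (replaceVar x y) xs))
  binR   : ∀ {o F F' G G'} → Rename x y F F' → Rename x y G G'
         → Rename x y (bin o F G) (bin o F' G')
  bound  : ∀ {q F} → Rename x y (quant q x F) (quant q x F)
  other  : ∀ {q z F F'} → ¬ (z ≡ x) → ¬ (z ≡ y) → Rename x y F F'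
         → Rename x y (quant q z F) (quant q z F')
  blocked : ∀ {q F} → ¬ (y ≡ x) → ¬ Free x F
          → Rename x y (quant q y F) (quant q y F)

-- The connective pulled by P↓ under a quantifier: ∃ with ∧, ∀ with ∨.
pOp : Quant → Op
pOp ex  = and
pOp all = or

-- The connective split by S↓: ∃ with ∨, ∀ with ∧.
sOp : Quant → Op
sOp ex  = or
sOp all = and

data Rule : Set where
  A C O P↓ P↑ N S↓ M : Rule

data Base : Rule → Formula → Formula → Set where
  assoc   : ∀ {o F₁ F₂ F₃} →
            Base A (bin o F₁ (bin o F₂ F₃)) (bin o (bin o F₁ F₂) F₃)
  assoc⁻  : ∀ {o F₁ F₂ F₃} →
            Base A (bin o (bin o F₁ F₂) F₃) (bin o F₁ (bin o F₂ F₃))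
  comm    : ∀ {o F₁ F₂} → Base C (bin o F₁ F₂) (bin o F₂ F₁)
  swap    : ∀ {q x y F} → Base O (quant q x (quant q y F)) (quant q y (quant q x F))
  pushP   : ∀ {q x F₁ F₂} → ¬ Free x F₂ →
            Base P↓ (quant q x (bin (pOp q) F₁ F₂)) (bin (pOp q) (quant q x F₁) F₂)
  pullP   : ∀ {q x F₁ F₂} → ¬ Free x F₂ →
            Base P↑ (bin (pOp q) (quant q x F₁) F₂) (quant q x (bin (pOp q) F₁ F₂))
  rename  : ∀ {q x y F F'} → ¬ Free y F → Rename x y F F' →
            Base N (quant q x F) (quant q y F')
  pushS   : ∀ {q x F₁ F₂} →
            Base S↓ (quant q x (bin (sOp q) F₁ F₂)) (bin (sOp q) (quant q x F₁) (quant q x F₂))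
  drop    : ∀ {q x F} → ¬ Free x F → Base M (quant q x F) F

data Step (𝓡 : Rule → Set) : Formula → Formula → Set where
  root   : ∀ {r F G} → 𝓡 r → Base r F G → Step 𝓡 F G
  inL    : ∀ {o F F' G} → Step 𝓡 F F' → Step 𝓡 (bin o F G) (bin o F' G)
  inR    : ∀ {o F G G'} → Step 𝓡 G G' → Step 𝓡 (bin o F G) (bin o F G')
  inQ    : ∀ {q x F F'} → Step 𝓡 F F' → Step 𝓡 (quant q x F) (quant q x F')

data ACO : Rule → Set where
  isA : ACO A
  isC : ACO C
  isO : ACO O

data 𝓣 : Rule → Set where
  isA : 𝓣 A
  isC : 𝓣 C
  isO : 𝓣 O
  isP↓ : 𝓣 P↓
  isP↑ : 𝓣 P↑
  isN : 𝓣 N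

data PSM : Rule → Set where
  isP↓ : PSM P↓
  isS↓ : PSM S↓
  isM  : PSM M

data SM : Rule → Set where
  isS↓ : SM S↓
  isM  : SM M

Equiv : (Rule → Set) → Formula → Formula → Set
Equiv 𝓡 = EqClosure (Step 𝓡)

IsNormalForm : {D : Set} → (D → D → Set) → D → Set
IsNormalForm _⟶_ d = ¬ (∃ λ d' → d ⟶ d')

-- (D, ⟶)/≈ with classes represented by their elements:
-- [a] ⟶ [b] iff some d ≈ a, d' ≈ b with d ⟶ d'.
QuotStep : {D : Set} → (D → D → Set) → (D → D → Set) → D → D → Set
QuotStep _≈_ _⟶_ a b = ∃ λ d → ∃ λ d' → (a ≈ d) × (b ≈ d') × (d ⟶ d')

IsNormalFormQ : {D : Set} → (D → D → Set) → (D → D → Set) → D → Set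
IsNormalFormQ _≈_ _⟶_ d = IsNormalForm (QuotStep _≈_ _⟶_) d

-- A formula hides a redex if it has a subformula Q x B where either x is not free in B,
-- or x is free in only one component L of the Q-block of B (the part built from
-- Q-quantifiers and the connective that P↓ moves out of Q: ∧ for ∃, ∨ for ∀), and L is
-- splittable for the dual quantifier: the leaves of its dual block can be coloured with two
-- colours, both used, so that each quantifier of that block binds a variable occurring
-- under one colour only.  An S↓- or M-redex is a hidden redex, and since 𝓣-steps are
-- invertible and only regroup blocks and rename bound variables, hidden redexes are
-- invariant under ↔*_𝓣.  Conversely, up to A, C and O a hidden redex is a P↓-, S↓- or
-- M-redex: if L ≠ B, a sibling of L is free of x and P↓ applies; if L = B, either B is an
-- sOp-formula and S↓ applies, or B starts with a dual quantifier, and walking down its block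
-- towards a leaf of the colour its variable avoids reaches a component without that
-- variable, to which P↓ or M applies, unless it meets a nested quantifier whose block again
-- uses both colours, where the argument recurses.
{-# OPTIONS --safe #-}
module Submission where

open import Defs
open import Data.Nat using (_≟_)
open import Data.Bool using (Bool; true; false; not)
open import Data.Bool.Properties using (not-¬)
open import Data.List using (map)
open import Data.List.Properties using (map-id; map-cong; map-∘; map-id-local)
open import Data.List.Relation.Unary.All using (tabulate)
open import Data.List.Membership.Propositional using (_∈_)
open import Data.List.Membership.Propositional.Properties using (∈-map⁺; ∈-map⁻)
open import Data.List.Membership.DecPropositional _≟_ using (_∈?_)
open import Data.Product using (Σ; _×_; ∃; ∃₂; _,_)
open import Data.Sum using (_⊎_; inj₁; inj₂)
open import Data.Empty using (⊥-elim)
open import Function using (_∘_)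
open import Relation.Nullary using (¬_; Dec; yes; no)
open import Relation.Binary.PropositionalEquality using (_≡_; _≢_; refl; sym; trans; cong; cong₂; subst)
open import Relation.Binary.Construct.Closure.ReflexiveTransitive using (ε; _◅_; _◅◅_)
open import Relation.Binary.Construct.Closure.Symmetric using (fwd; bwd)
open import Relation.Binary.Construct.Closure.Equivalence using (gmap; return)

private
  variable
    q q' : Quant
    o : Op
    x y z z' v : Var
    b : Bool
    F F' G F₁ F₂ F₃ : Formula

flipQ : Quant → Quant
flipQ ex  = all
flipQ all = ex

pOp-injective : pOp q ≡ pOp q' → q ≡ q'
pOp-injective {ex}  {ex}  _ = refl
pOp-injective {all} {all} _ = refl

sOp≡pOp∘flipQ : ∀ q → sOp q ≡ pOp (flipQ q)
sOp≡pOp∘flipQ ex  = refl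
sOp≡pOp∘flipQ all = refl

pOp≢pOp∘flipQ : ∀ q → pOp q ≢ pOp (flipQ q)
pOp≢pOp∘flipQ ex  ()
pOp≢pOp∘flipQ all ()

bin-fresh : ¬ Free x F → ¬ Free x G → ¬ Free x (bin o F G)
bin-fresh x∉F x∉G (binL xF) = x∉F xF
bin-fresh x∉F x∉G (binR xG) = x∉G xG

quant-fresh : ¬ Free x F → ¬ Free x (quant q z F)
quant-fresh x∉F (quantF _ xF) = x∉F xF

free? : ∀ x F → Dec (Free x F)
free? x (atom R xs) with x ∈? xs
... | yes x∈ = yes (atomF x∈)
... | no x∉  = no λ { (atomF x∈) → x∉ x∈ }
free? x (bin o F G) with free? x F | free? x G
... | yes xF | _      = yes (binL xF)
... | no _   | yes xG = yes (binR xG)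
... | no x∉F | no x∉G = no (bin-fresh x∉F x∉G)
free? x (quant q z F) with z ≟ x | free? x F
... | yes z≡x | _      = no λ { (quantF z≢x _) → z≢x z≡x }
... | no z≢x  | yes xF = yes (quantF z≢x xF)
... | no _    | no x∉F = no (quant-fresh x∉F)

replaceVar-≡ : ∀ x y → replaceVar x y x ≡ y
replaceVar-≡ x y with x ≟ x
... | yes _   = refl
... | no x≢x = ⊥-elim (x≢x refl)

replaceVar-≢ : v ≢ x → replaceVar x y v ≡ v
replaceVar-≢ {v} {x} v≢x with v ≟ x
... | yes v≡x = ⊥-elim (v≢x v≡x)
... | no _    = refl

replaceVar-self : ∀ x v → replaceVar x x v ≡ v
replaceVar-self x v with v ≟ x
... | yes v≡x = sym v≡x
... | no _    = refl

replaceVar-inverse : ∀ x y v → v ≢ y → replaceVar y x (replaceVar x y v) ≡ v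
replaceVar-inverse x y v v≢y with v ≟ x
... | yes v≡x = trans (replaceVar-≡ y x) (sym v≡x)
... | no _    = replaceVar-≢ v≢y

rename-self⇒≡ : Rename x x F F' → F ≡ F'
rename-self⇒≡ {x} (atomR {R} {xs}) = cong (atom R) (sym (trans (map-cong (replaceVar-self x) xs) (map-id xs)))
rename-self⇒≡ (binR r s)          = cong₂ (bin _) (rename-self⇒≡ r) (rename-self⇒≡ s)
rename-self⇒≡ bound               = refl
rename-self⇒≡ (other _ _ r)       = cong (quant _ _) (rename-self⇒≡ r)
rename-self⇒≡ (blocked x≢x _)     = ⊥-elim (x≢x refl)

rename-free⁻ : Rename x y F F' → Free v F' → (v ≡ y × Free x F) ⊎ (v ≢ x × Free v F)
rename-free⁻ {x} {y} (atomR {xs = xs}) (atomF v∈) with ∈-map⁻ (replaceVar x y) v∈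
... | u , u∈ , refl with u ≟ x
...   | yes refl = inj₁ (refl , atomF u∈)
...   | no u≢x   = inj₂ (u≢x , atomF u∈)
rename-free⁻ (binR r _) (binL vF) with rename-free⁻ r vF
... | inj₁ (v≡y , xF) = inj₁ (v≡y , binL xF)
... | inj₂ (v≢x , vF) = inj₂ (v≢x , binL vF)
rename-free⁻ (binR _ r) (binR vG) with rename-free⁻ r vG
... | inj₁ (v≡y , xG) = inj₁ (v≡y , binR xG)
... | inj₂ (v≢x , vG) = inj₂ (v≢x , binR vG)
rename-free⁻ bound (quantF x≢v vF) = inj₂ ((λ v≡x → x≢v (sym v≡x)) , quantF x≢v vF)
rename-free⁻ (other z≢x _ r) (quantF z≢v vF) with rename-free⁻ r vF
... | inj₁ (v≡y , xF) = inj₁ (v≡y , quantF z≢x xF)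
... | inj₂ (v≢x , vF) = inj₂ (v≢x , quantF z≢v vF)
rename-free⁻ (blocked _ x∉F) (quantF y≢v vF) =
  inj₂ ((λ { refl → x∉F vF }) , quantF y≢v vF)

rename-free-other⁺ : Rename x y F F' → Free v F → v ≢ x → Free v F'
rename-free-other⁺ {x} {y} (atomR {xs = xs}) (atomF v∈) v≢x =
  atomF (subst (_∈ map (replaceVar x y) xs) (replaceVar-≢ v≢x) (∈-map⁺ (replaceVar x y) v∈))
rename-free-other⁺ (binR r _) (binL vF) v≢x      = binL (rename-free-other⁺ r vF v≢x)
rename-free-other⁺ (binR _ r) (binR vG) v≢x      = binR (rename-free-other⁺ r vG v≢x)
rename-free-other⁺ bound vF _                    = vF
rename-free-other⁺ (other _ _ r) (quantF z≢v vF) v≢x = quantF z≢v (rename-free-other⁺ r vF v≢x)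
rename-free-other⁺ (blocked _ _) vF _            = vF

rename-free-renamed⁺ : Rename x y F F' → Free x F → Free y F'
rename-free-renamed⁺ {x} {y} (atomR {xs = xs}) (atomF x∈) =
  atomF (subst (_∈ map (replaceVar x y) xs) (replaceVar-≡ x y) (∈-map⁺ (replaceVar x y) x∈))
rename-free-renamed⁺ (binR r _) (binL xF)          = binL (rename-free-renamed⁺ r xF)
rename-free-renamed⁺ (binR _ r) (binR xG)          = binR (rename-free-renamed⁺ r xG)
rename-free-renamed⁺ bound (quantF x≢x _)          = ⊥-elim (x≢x refl)
rename-free-renamed⁺ (other _ z≢y r) (quantF _ xF) = quantF z≢y (rename-free-renamed⁺ r xF)
rename-free-renamed⁺ (blocked _ x∉F) (quantF _ xF) = ⊥-elim (x∉F xF)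

rename-removes : Rename x y F F' → x ≢ y → ¬ Free x F'
rename-removes r x≢y xF' with rename-free⁻ r xF'
... | inj₁ (x≡y , _) = x≢y x≡y
... | inj₂ (x≢x , _) = x≢x refl

rename-free-other⁻ : Rename x y F F' → v ≢ y → Free v F' → Free v F
rename-free-other⁻ r v≢y vF' with rename-free⁻ r vF'
... | inj₁ (v≡y , _) = ⊥-elim (v≢y v≡y)
... | inj₂ (_ , vF)  = vF

rename-free-renamed⁻ : Rename x y F F' → ¬ Free y F → Free y F' → Free x F
rename-free-renamed⁻ r y∉ yF' with rename-free⁻ r yF'
... | inj₁ (_ , xF) = xF
... | inj₂ (_ , yF) = ⊥-elim (y∉ yF)

rename-inverse : Rename x y F F' → ¬ Free y F → x ≢ y → Rename y x F' F
rename-inverse {x} {y} (atomR {R} {xs}) y∉ x≢y =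
  subst (λ ys → Rename y x (atom R (map (replaceVar x y) xs)) (atom R ys)) map-back atomR
  where
    map-back : map (replaceVar y x) (map (replaceVar x y) xs) ≡ xs
    map-back = trans (sym (map-∘ xs))
      (map-id-local (tabulate λ v∈ → replaceVar-inverse x y _ λ { refl → y∉ (atomF v∈) }))
rename-inverse (binR r s) y∉ x≢y =
  binR (rename-inverse r (y∉ ∘ binL) x≢y) (rename-inverse s (y∉ ∘ binR) x≢y)
rename-inverse bound y∉ x≢y            = blocked x≢y (y∉ ∘ quantF x≢y)
rename-inverse (other z≢x z≢y r) y∉ x≢y = other z≢y z≢x (rename-inverse r (y∉ ∘ quantF z≢y) x≢y)
rename-inverse (blocked _ _) _ _        = bound

rename-sym : ¬ Free y F → Rename x y F F' → ¬ Free x F' × Rename y x F' F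
rename-sym {y} {x = x} y∉ r with x ≟ y
... | no x≢y   = rename-removes r x≢y , rename-inverse r y∉ x≢y
... | yes refl with rename-self⇒≡ r
...   | refl = y∉ , r

𝓣-step-sym : Step 𝓣 F G → Step 𝓣 G F
𝓣-step-sym (root isA assoc)           = root isA assoc⁻
𝓣-step-sym (root isA assoc⁻)          = root isA assoc
𝓣-step-sym (root isC comm)            = root isC comm
𝓣-step-sym (root isO swap)            = root isO swap
𝓣-step-sym (root isP↓ (pushP x∉))     = root isP↑ (pullP x∉)
𝓣-step-sym (root isP↑ (pullP x∉))     = root isP↓ (pushP x∉)
𝓣-step-sym (root isN (rename y∉ r)) with rename-sym y∉ r
... | x∉ , r⁻¹ = root isN (rename x∉ r⁻¹)
𝓣-step-sym (inL s) = inL (𝓣-step-sym s)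
𝓣-step-sym (inR s) = inR (𝓣-step-sym s)
𝓣-step-sym (inQ s) = inQ (𝓣-step-sym s)

𝓣-step-free : Step 𝓣 F G → Free v F → Free v G
𝓣-step-free (root isA assoc) (binL vF)                   = binL (binL vF)
𝓣-step-free (root isA assoc) (binR (binL vF))            = binL (binR vF)
𝓣-step-free (root isA assoc) (binR (binR vF))            = binR vF
𝓣-step-free (root isA assoc⁻) (binL (binL vF))           = binL vF
𝓣-step-free (root isA assoc⁻) (binL (binR vF))           = binR (binL vF)
𝓣-step-free (root isA assoc⁻) (binR vF)                  = binR (binR vF)
𝓣-step-free (root isC comm) (binL vF)                    = binR vF
𝓣-step-free (root isC comm) (binR vF)                    = binL vF
𝓣-step-free (root isO swap) (quantF x≢v (quantF y≢v vF)) = quantF y≢v (quantF x≢v vF)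
𝓣-step-free (root isP↓ (pushP _)) (quantF x≢v (binL vF)) = binL (quantF x≢v vF)
𝓣-step-free (root isP↓ (pushP _)) (quantF _ (binR vF))   = binR vF
𝓣-step-free (root isP↑ (pullP _)) (binL (quantF x≢v vF)) = quantF x≢v (binL vF)
𝓣-step-free (root isP↑ (pullP x∉)) (binR vF)             = quantF (λ { refl → x∉ vF }) (binR vF)
𝓣-step-free (root isN (rename y∉ r)) (quantF x≢v vF)     =
  quantF (λ { refl → y∉ vF }) (rename-free-other⁺ r vF λ { refl → x≢v refl })
𝓣-step-free (inL s) (binL vF) = binL (𝓣-step-free s vF)
𝓣-step-free (inL s) (binR vG) = binR vG
𝓣-step-free (inR s) (binL vF) = binL vF
𝓣-step-free (inR s) (binR vG) = binR (𝓣-step-free s vG)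
𝓣-step-free (inQ s) (quantF x≢v vF) = quantF x≢v (𝓣-step-free s vF)

𝓣-step-free⁻ : Step 𝓣 F G → Free v G → Free v F
𝓣-step-free⁻ s = 𝓣-step-free (𝓣-step-sym s)

-- Splittable blocks

-- Colours an initial part of the q-block; a leaf may be any subformula.  The connective of
-- a node is fixed by an equation rather than written pOp q, so that matching on a P↑-step,
-- whose connective is pOp q' for an unrelated q', does not get stuck.
data Colouring (q : Quant) : Formula → Set where
  node : o ≡ pOp q → Colouring q F → Colouring q G → Colouring q (bin o F G)
  bind : Colouring q F → Colouring q (quant q z F)
  leaf : Bool → Colouring q F

module _ {q : Quant} where

  private
    variable
      e : o ≡ pOp q
      c : Colouring q F
      c₁ : Colouring q F₁
      c₂ : Colouring q F₂

  data Uses (b : Bool) : Colouring q F → Set where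
    left  : Uses b c₁ → Uses b (node e c₁ c₂)
    right : Uses b c₂ → Uses b (node e c₁ c₂)
    under : Uses b c → Uses b (bind {z = z} c)
    leaf  : Uses b (leaf {F = F} b)

  data Confined (y : Var) (b : Bool) : Colouring q F → Set where
    node  : Confined y b c₁ → Confined y b c₂ → Confined y b (node e c₁ c₂)
    bound : Confined y b (bind {z = y} c)
    under : z ≢ y → Confined y b c → Confined y b (bind {z = z} c)
    leaf  : ∀ {b'} → (Free y F → b' ≡ b) → Confined y b (leaf {F = F} b')

  data Proper : Colouring q F → Set where
    node : Proper c₁ → Proper c₂ → Proper (node e c₁ c₂)
    bind : Confined z b c → Proper c → Proper (bind {z = z} c)
    leaf : Proper (leaf {F = F} b)

  confined-fresh : ¬ Free y F → (c : Colouring q F) → Confined y b c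
  confined-fresh y∉ (node e c₁ c₂) = node (confined-fresh (y∉ ∘ binL) c₁) (confined-fresh (y∉ ∘ binR) c₂)
  confined-fresh {y = y} y∉ (bind {z = z} c) with z ≟ y
  ... | yes refl = bound
  ... | no z≢y   = under z≢y (confined-fresh (y∉ ∘ quantF z≢y) c)
  confined-fresh y∉ (leaf b) = leaf (⊥-elim ∘ y∉)

  confined-uses : {c : Colouring q F} → Confined y b c → Free y F → Uses b c
  confined-uses (node a₁ a₂) (binL yF)    = left (confined-uses a₁ yF)
  confined-uses (node a₁ a₂) (binR yG)    = right (confined-uses a₂ yG)
  confined-uses bound (quantF y≢y _)      = ⊥-elim (y≢y refl)
  confined-uses (under _ a) (quantF _ yF) = under (confined-uses a yF)
  confined-uses (leaf same) yF with same yF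
  ... | refl = leaf

record Splittable (q : Quant) (F : Formula) : Set where
  constructor split
  field
    colouring  : Colouring q F
    uses-true  : Uses true colouring
    uses-false : Uses false colouring
    proper     : Proper colouring

bin-splittable : o ≡ pOp q → Splittable q (bin o F G)
bin-splittable e = split (node e (leaf true) (leaf false)) (left leaf) (right leaf) (node leaf leaf)

record _⇛_ {q F G} (c : Colouring q F) (c' : Colouring q G) : Set where
  field
    uses     : ∀ {b} → Uses b c → Uses b c'
    confined : ∀ {v b} → Confined v b c → Confined v b c'
    proper   : Proper c → Proper c'

record Renamed {q F G} (x y : Var) (c : Colouring q F) (c' : Colouring q G) : Set where
  field
    uses             : ∀ {b} → Uses b c → Uses b c'
    confined-other   : ∀ {v b} → v ≢ x → v ≢ y → Confined v b c → Confined v b c'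
    confined-renamed : ∀ {b} → Confined x b c → Confined y b c'
    proper           : Proper c → Proper c'

open _⇛_
open Renamed

module _ {q : Quant} where

  private
    variable
      e e' : o ≡ pOp q
      c : Colouring q F
      c' : Colouring q G
      c₁ c₁' : Colouring q F₁
      c₂ c₂' : Colouring q F₂
      c₃ : Colouring q F₃

  ⇛-refl : c ⇛ c
  uses     ⇛-refl u = u
  confined ⇛-refl a = a
  proper   ⇛-refl m = m

  ⇛-trans : c₁ ⇛ c₂ → c₂ ⇛ c₃ → c₁ ⇛ c₃
  uses     (⇛-trans p p') = uses p' ∘ uses p
  confined (⇛-trans p p') = confined p' ∘ confined p
  proper   (⇛-trans p p') = proper p' ∘ proper p

  node-⇛ : c₁ ⇛ c₁' → c₂ ⇛ c₂' → node e c₁ c₂ ⇛ node e c₁' c₂'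
  uses     (node-⇛ p₁ p₂) (left u)     = left (uses p₁ u)
  uses     (node-⇛ p₁ p₂) (right u)    = right (uses p₂ u)
  confined (node-⇛ p₁ p₂) (node a₁ a₂) = node (confined p₁ a₁) (confined p₂ a₂)
  proper   (node-⇛ p₁ p₂) (node m₁ m₂) = node (proper p₁ m₁) (proper p₂ m₂)

  bind-⇛ : c ⇛ c' → bind {z = z} c ⇛ bind {z = z} c'
  uses     (bind-⇛ p) (under u)   = under (uses p u)
  confined (bind-⇛ p) bound       = bound
  confined (bind-⇛ p) (under n a) = under n (confined p a)
  proper   (bind-⇛ p) (bind a m)  = bind (confined p a) (proper p m)

  leaf-⇛ : (∀ {v} → Free v G → Free v F) → leaf {q} {F} b ⇛ leaf {q} {G} b
  uses     (leaf-⇛ _) leaf            = leaf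
  confined (leaf-⇛ free⁻) (leaf same) = leaf (same ∘ free⁻)
  proper   (leaf-⇛ _) leaf            = leaf

  leaf⇛node : (e : o ≡ pOp q) → leaf {F = bin o F₁ F₂} b ⇛ node e (leaf b) (leaf b)
  uses     (leaf⇛node e) leaf        = left leaf
  confined (leaf⇛node e) (leaf same) = node (leaf (same ∘ binL)) (leaf (same ∘ binR))
  proper   (leaf⇛node e) leaf        = node leaf leaf

  leaf⇛bind : leaf {q} {quant q z F} b ⇛ bind (leaf b)
  uses     leaf⇛bind leaf = under leaf
  confined (leaf⇛bind {z = z}) {v} (leaf same) with z ≟ v
  ... | yes refl = bound
  ... | no z≢v   = under z≢v (leaf (same ∘ quantF z≢v))
  proper   leaf⇛bind leaf = bind (leaf λ _ → refl) leaf

  assocᶜ : node e c₁ (node e' c₂ c₃) ⇛ node e (node e' c₁ c₂) c₃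
  uses     assocᶜ (left u)               = left (left u)
  uses     assocᶜ (right (left u))       = left (right u)
  uses     assocᶜ (right (right u))      = right u
  confined assocᶜ (node a₁ (node a₂ a₃)) = node (node a₁ a₂) a₃
  proper   assocᶜ (node m₁ (node m₂ m₃)) = node (node m₁ m₂) m₃

  assoc⁻ᶜ : node e (node e' c₁ c₂) c₃ ⇛ node e c₁ (node e' c₂ c₃)
  uses     assoc⁻ᶜ (left (left u))        = left u
  uses     assoc⁻ᶜ (left (right u))       = right (left u)
  uses     assoc⁻ᶜ (right u)              = right (right u)
  confined assoc⁻ᶜ (node (node a₁ a₂) a₃) = node a₁ (node a₂ a₃)
  proper   assoc⁻ᶜ (node (node m₁ m₂) m₃) = node m₁ (node m₂ m₃)

  commᶜ : node e c₁ c₂ ⇛ node e c₂ c₁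
  uses     commᶜ (left u)     = right u
  uses     commᶜ (right u)    = left u
  confined commᶜ (node a₁ a₂) = node a₂ a₁
  proper   commᶜ (node m₁ m₂) = node m₂ m₁

  swapᶜ : z ≢ z' → bind {z = z} (bind {z = z'} c) ⇛ bind {z = z'} (bind {z = z} c)
  uses     (swapᶜ z≢z') (under (under u))                = under (under u)
  confined (swapᶜ z≢z') bound                            = under (z≢z' ∘ sym) bound
  confined (swapᶜ z≢z') (under _ bound)                  = bound
  confined (swapᶜ z≢z') (under n (under n' a))           = under n' (under n a)
  proper   (swapᶜ z≢z') (bind bound _)                   = ⊥-elim (z≢z' refl)
  proper   (swapᶜ z≢z') (bind (under _ a) (bind a' m))   = bind (under z≢z' a') (bind a m)

  pushᶜ : {c₂ : Colouring q F₂} → ¬ Free z F₂ → bind {z = z} (node e c₁ c₂) ⇛ node e (bind {z = z} c₁) c₂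
  uses     (pushᶜ z∉) (under (left u))                     = left (under u)
  uses     (pushᶜ z∉) (under (right u))                    = right u
  confined (pushᶜ {c₂ = c₂} z∉) bound                      = node bound (confined-fresh z∉ c₂)
  confined (pushᶜ z∉) (under n (node a₁ a₂))               = node (under n a₁) a₂
  proper   (pushᶜ z∉) (bind (node a₁ a₂) (node m₁ m₂))     = node (bind a₁ m₁) m₂

  pullᶜ : {c₂ : Colouring q F₂} → ¬ Free z F₂ → node e (bind {z = z} c₁) c₂ ⇛ bind {z = z} (node e c₁ c₂)
  uses     (pullᶜ z∉) (left (under u))                     = under (left u)
  uses     (pullᶜ z∉) (right u)                            = under (right u)
  confined (pullᶜ z∉) (node bound _)                       = bound
  confined (pullᶜ z∉) (node (under n a₁) a₂)               = under n (node a₁ a₂)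
  proper   (pullᶜ {c₂ = c₂} z∉) (node (bind a m₁) m₂)      = bind (node a (confined-fresh z∉ c₂)) (node m₁ m₂)

  renamed-fresh : {c : Colouring q F} → ¬ Free y F → Renamed x y c c
  uses             (renamed-fresh _) u     = u
  confined-other   (renamed-fresh _) _ _ a = a
  confined-renamed (renamed-fresh {c = c} y∉) _ = confined-fresh y∉ c
  proper           (renamed-fresh _) m     = m

  leaf-renamed : Rename x y F F' → ¬ Free y F → Renamed x y (leaf {q} {F} b) (leaf {q} {F'} b)
  uses             (leaf-renamed r y∉) leaf                  = leaf
  confined-other   (leaf-renamed r y∉) _ v≢y (leaf same)     = leaf (same ∘ rename-free-other⁻ r v≢y)
  confined-renamed (leaf-renamed r y∉) (leaf same)           = leaf (same ∘ rename-free-renamed⁻ r y∉)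
  proper           (leaf-renamed r y∉) leaf                  = leaf

  node-renamed : Renamed x y c₁ c₁' → Renamed x y c₂ c₂' → Renamed x y (node e c₁ c₂) (node e c₁' c₂')
  uses             (node-renamed p₁ p₂) (left u)             = left (uses p₁ u)
  uses             (node-renamed p₁ p₂) (right u)            = right (uses p₂ u)
  confined-other   (node-renamed p₁ p₂) v≢x v≢y (node a₁ a₂) =
    node (confined-other p₁ v≢x v≢y a₁) (confined-other p₂ v≢x v≢y a₂)
  confined-renamed (node-renamed p₁ p₂) (node a₁ a₂)         = node (confined-renamed p₁ a₁) (confined-renamed p₂ a₂)
  proper           (node-renamed p₁ p₂) (node m₁ m₂)         = node (proper p₁ m₁) (proper p₂ m₂)

  bind-renamed : z ≢ x → z ≢ y → Renamed x y c c' → Renamed x y (bind {z = z} c) (bind {z = z} c')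
  uses             (bind-renamed _ _ p) (under u)           = under (uses p u)
  confined-other   (bind-renamed _ _ p) _ _ bound           = bound
  confined-other   (bind-renamed _ _ p) v≢x v≢y (under n a) = under n (confined-other p v≢x v≢y a)
  confined-renamed (bind-renamed z≢x _ p) bound             = ⊥-elim (z≢x refl)
  confined-renamed (bind-renamed _ z≢y p) (under _ a)       = under z≢y (confined-renamed p a)
  proper           (bind-renamed z≢x z≢y p) (bind a m)      = bind (confined-other p z≢x z≢y a) (proper p m)

  colouring-rename : ¬ Free y F → Rename x y F F' → (c : Colouring q F) → Σ (Colouring q F') (Renamed x y c)
  colouring-rename y∉ r (leaf b)      = leaf b , leaf-renamed r y∉
  colouring-rename y∉ bound c         = c , renamed-fresh y∉
  colouring-rename y∉ (blocked _ _) c = c , renamed-fresh y∉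
  colouring-rename y∉ (binR r₁ r₂) (node e c₁ c₂)
    with colouring-rename (y∉ ∘ binL) r₁ c₁ | colouring-rename (y∉ ∘ binR) r₂ c₂
  ... | c₁' , p₁ | c₂' , p₂ = node e c₁' c₂' , node-renamed p₁ p₂
  colouring-rename y∉ (other z≢x z≢y r) (bind c) with colouring-rename (y∉ ∘ quantF z≢y) r c
  ... | c' , p = bind c' , bind-renamed z≢x z≢y p

  bind-rename-⇛ : {c : Colouring q F} {c' : Colouring q F'} → Rename x y F F' → Renamed x y c c' → bind {z = x} c ⇛ bind {z = y} c'
  uses     (bind-rename-⇛ r p) (under u)  = under (uses p u)
  proper   (bind-rename-⇛ r p) (bind a m) = bind (confined-renamed p a) (proper p m)
  confined (bind-rename-⇛ {y = y} r p) {v} a with v ≟ y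
  ... | yes refl = bound
  confined (bind-rename-⇛ {c' = c'} r p) bound | no x≢y =
    under (x≢y ∘ sym) (confined-fresh (rename-removes r x≢y) c')
  confined (bind-rename-⇛ r p) (under x≢v a) | no v≢y =
    under (v≢y ∘ sym) (confined-other p (x≢v ∘ sym) v≢y a)

  colouring-step : (c : Colouring q F) → Step 𝓣 F G → Σ (Colouring q G) (c ⇛_)
  colouring-step (leaf b) s = leaf b , leaf-⇛ (𝓣-step-free⁻ s)
  colouring-step (node e c₁ c₂) (inL s) with colouring-step c₁ s
  ... | c₁' , p = node e c₁' c₂ , node-⇛ p ⇛-refl
  colouring-step (node e c₁ c₂) (inR s) with colouring-step c₂ s
  ... | c₂' , p = node e c₁ c₂' , node-⇛ ⇛-refl p
  colouring-step (bind c) (inQ s) with colouring-step c s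
  ... | c' , p = bind c' , bind-⇛ p
  colouring-step (node e c₁ (node e' c₂ c₃)) (root isA assoc)  = _ , assocᶜ
  colouring-step (node e c₁ (leaf b))        (root isA assoc)  = _ , ⇛-trans (node-⇛ ⇛-refl (leaf⇛node e)) assocᶜ
  colouring-step (node e (node e' c₁ c₂) c₃) (root isA assoc⁻) = _ , assoc⁻ᶜ
  colouring-step (node e (leaf b) c₃)        (root isA assoc⁻) = _ , ⇛-trans (node-⇛ (leaf⇛node e) ⇛-refl) assoc⁻ᶜ
  colouring-step (node e c₁ c₂)              (root isC comm)   = _ , commᶜ
  colouring-step (bind {z = z} c) (root isO (swap {y = z'})) with z ≟ z'
  ... | yes refl = _ , ⇛-refl
  colouring-step (bind (bind c)) (root isO swap) | no z≢z' = _ , swapᶜ z≢z'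
  colouring-step (bind (leaf b)) (root isO swap) | no z≢z' = _ , ⇛-trans (bind-⇛ leaf⇛bind) (swapᶜ z≢z')
  colouring-step (bind (node e c₁ c₂)) (root isP↓ (pushP z∉)) = _ , pushᶜ z∉
  colouring-step (bind (leaf b))       (root isP↓ (pushP z∉)) = _ , ⇛-trans (bind-⇛ (leaf⇛node refl)) (pushᶜ z∉)
  colouring-step (node e (bind c₁) c₂) (root isP↑ (pullP z∉)) = _ , pullᶜ z∉
  colouring-step (node e (leaf b) c₂)  (root isP↑ (pullP z∉)) with pOp-injective e
  ... | refl = _ , ⇛-trans (node-⇛ leaf⇛bind ⇛-refl) (pullᶜ z∉)
  colouring-step (bind c) (root isN (rename y∉ r)) with colouring-rename y∉ r c
  ... | c' , p = bind c' , bind-rename-⇛ r p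

splittable-step : Splittable q F → Step 𝓣 F G → Splittable q G
splittable-step (split c t f m) s with colouring-step c s
... | c' , p = split c' (uses p t) (uses p f) (proper p m)

splittable-rename : ¬ Free y F → Rename x y F F' → Splittable q F → Splittable q F'
splittable-rename y∉ r (split c t f m) with colouring-rename y∉ r c
... | c' , p = split c' (uses p t) (uses p f) (proper p m)

dual-bin-unsplittable : o ≡ pOp q → ¬ Splittable (flipQ q) (bin o F G)
dual-bin-unsplittable e (split (leaf _) leaf () _)
dual-bin-unsplittable {q = q} e (split (node e' _ _) _ _ _) = pOp≢pOp∘flipQ q (trans (sym e) e')

dual-quant-unsplittable : ¬ Splittable (flipQ q) (quant q z F)
dual-quant-unsplittable {ex}  (split (leaf _) leaf () _)
dual-quant-unsplittable {all} (split (leaf _) leaf () _)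

-- Hidden redexes

data SoleSplittable (q : Quant) (x : Var) : Formula → Set where
  left  : o ≡ pOp q → SoleSplittable q x F → ¬ Free x G → SoleSplittable q x (bin o F G)
  right : o ≡ pOp q → ¬ Free x F → SoleSplittable q x G → SoleSplittable q x (bin o F G)
  under : z ≢ x → SoleSplittable q x F → SoleSplittable q x (quant q z F)
  here  : Free x F → Splittable (flipQ q) F → SoleSplittable q x F

sole-free : SoleSplittable q x F → Free x F
sole-free (left _ S _)  = binL (sole-free S)
sole-free (right _ _ S) = binR (sole-free S)
sole-free (under n S)   = quantF n (sole-free S)
sole-free (here xF _)   = xF

sole-rename-other : SoleSplittable q v F → Rename x y F F' → ¬ Free y F → v ≢ x → v ≢ y → SoleSplittable q v F'
sole-rename-other (left e S v∉G) (binR r₁ r₂) y∉ v≢x v≢y =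
  left e (sole-rename-other S r₁ (y∉ ∘ binL) v≢x v≢y) (v∉G ∘ rename-free-other⁻ r₂ v≢y)
sole-rename-other (right e v∉F S) (binR r₁ r₂) y∉ v≢x v≢y =
  right e (v∉F ∘ rename-free-other⁻ r₁ v≢y) (sole-rename-other S r₂ (y∉ ∘ binR) v≢x v≢y)
sole-rename-other (under n S) bound _ _ _         = under n S
sole-rename-other (under n S) (blocked _ _) _ _ _ = under n S
sole-rename-other (under n S) (other _ z≢y r) y∉ v≢x v≢y =
  under n (sole-rename-other S r (y∉ ∘ quantF z≢y) v≢x v≢y)
sole-rename-other (here vF D) r y∉ v≢x _ = here (rename-free-other⁺ r vF v≢x) (splittable-rename y∉ r D)

sole-rename : SoleSplittable q x F → Rename x y F F' → ¬ Free y F → SoleSplittable q y F'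
sole-rename (left e S x∉G) (binR r₁ r₂) y∉ =
  left e (sole-rename S r₁ (y∉ ∘ binL)) (x∉G ∘ rename-free-renamed⁻ r₂ (y∉ ∘ binR))
sole-rename (right e x∉F S) (binR r₁ r₂) y∉ =
  right e (x∉F ∘ rename-free-renamed⁻ r₁ (y∉ ∘ binL)) (sole-rename S r₂ (y∉ ∘ binR))
sole-rename (under x≢x _) bound _             = ⊥-elim (x≢x refl)
sole-rename (under _ S) (blocked _ x∉) _      = ⊥-elim (x∉ (sole-free S))
sole-rename (under n S) (other _ z≢y r) y∉    = under z≢y (sole-rename S r (y∉ ∘ quantF z≢y))
sole-rename (here xF D) r y∉ = here (rename-free-renamed⁺ r xF) (splittable-rename y∉ r D)

sole-root : ∀ {r} → SoleSplittable q x F → 𝓣 r → Base r F G → SoleSplittable q x G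
sole-root (here xF D) t s = here (𝓣-step-free (root t s) xF) (splittable-step D (root t s))
sole-root (left e S x∉) isA assoc                     = left e (left e S (x∉ ∘ binL)) (x∉ ∘ binR)
sole-root (right e x∉ (left _ S x∉₃)) isA assoc       = left e (right e x∉ S) x∉₃
sole-root (right e x∉₁ (right _ x∉₂ S)) isA assoc     = right e (bin-fresh x∉₁ x∉₂) S
sole-root (right e _ (here _ D)) isA assoc            = ⊥-elim (dual-bin-unsplittable e D)
sole-root (right e x∉ S) isA assoc⁻                   = right e (x∉ ∘ binL) (right e (x∉ ∘ binR) S)
sole-root (left e (right _ x∉₁ S) x∉) isA assoc⁻      = right e x∉₁ (left e S x∉)
sole-root (left e (left _ S x∉₂) x∉₃) isA assoc⁻      = left e S (bin-fresh x∉₂ x∉₃)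
sole-root (left e (here _ D) _) isA assoc⁻            = ⊥-elim (dual-bin-unsplittable e D)
sole-root (left e S x∉) isC comm                      = right e x∉ S
sole-root (right e x∉ S) isC comm                     = left e S x∉
sole-root (under n (under n' S)) isO swap             = under n' (under n S)
sole-root (under _ (here _ D)) isO swap               = ⊥-elim (dual-quant-unsplittable D)
sole-root (under n (left e S x∉₂)) isP↓ (pushP _)     = left e (under n S) x∉₂
sole-root (under n (right e x∉₁ S)) isP↓ (pushP _)    = right e (quant-fresh x∉₁) S
sole-root (under _ (here _ D)) isP↓ (pushP _)         = ⊥-elim (dual-bin-unsplittable refl D)
sole-root (left e (under n S) x∉) isP↑ (pullP _)      = under n (left e S x∉)
sole-root (left e (here _ D) _) isP↑ (pullP _) with pOp-injective e
... | refl = ⊥-elim (dual-quant-unsplittable D)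
sole-root {x = x} (right e x∉ S) isP↑ (pullP {x = z} z∉) with pOp-injective e
... | refl = under z≢x (right e (x∉ ∘ quantF z≢x) S)
  where
    z≢x : z ≢ x
    z≢x refl = z∉ (sole-free S)
sole-root {x = x} (under n S) isN (rename {y = y} y∉ r) =
  under y≢x (sole-rename-other S r y∉ (n ∘ sym) (y≢x ∘ sym))
  where
    y≢x : y ≢ x
    y≢x refl = y∉ (sole-free S)

sole-step : SoleSplittable q x F → Step 𝓣 F G → SoleSplittable q x G
sole-step S               (root t s) = sole-root S t s
sole-step (here xF D)     s          = here (𝓣-step-free s xF) (splittable-step D s)
sole-step (left e S x∉)   (inL s)    = left e (sole-step S s) x∉
sole-step (left e S x∉)   (inR s)    = left e S (x∉ ∘ 𝓣-step-free⁻ s)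
sole-step (right e x∉ S)  (inL s)    = right e (x∉ ∘ 𝓣-step-free⁻ s) S
sole-step (right e x∉ S)  (inR s)    = right e x∉ (sole-step S s)
sole-step (under n S)     (inQ s)    = under n (sole-step S s)

data HiddenRedex : Formula → Set where
  vacuous : ¬ Free x F → HiddenRedex (quant q x F)
  sole    : SoleSplittable q x F → HiddenRedex (quant q x F)
  inL     : HiddenRedex F → HiddenRedex (bin o F G)
  inR     : HiddenRedex G → HiddenRedex (bin o F G)
  inQ     : HiddenRedex F → HiddenRedex (quant q x F)

sm-step⇒hidden : Step SM F G → HiddenRedex F
sm-step⇒hidden (root isS↓ (pushS {q} {x} {F₁} {F₂})) with free? x (bin (sOp q) F₁ F₂)
... | no x∉  = vacuous x∉
... | yes xF = sole (here xF (bin-splittable (sOp≡pOp∘flipQ q)))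
sm-step⇒hidden (root isM (drop x∉)) = vacuous x∉
sm-step⇒hidden (inL s) = inL (sm-step⇒hidden s)
sm-step⇒hidden (inR s) = inR (sm-step⇒hidden s)
sm-step⇒hidden (inQ s) = inQ (sm-step⇒hidden s)

hidden-rename : HiddenRedex F → Rename x y F F' → ¬ Free y F → HiddenRedex F'
hidden-rename (inL h) (binR r₁ _) y∉ = inL (hidden-rename h r₁ (y∉ ∘ binL))
hidden-rename (inR h) (binR _ r₂) y∉ = inR (hidden-rename h r₂ (y∉ ∘ binR))
hidden-rename h bound _              = h
hidden-rename h (blocked _ _) _      = h
hidden-rename (vacuous z∉) (other _ z≢y r) _ = vacuous (z∉ ∘ rename-free-other⁻ r z≢y)
hidden-rename (sole S) (other z≢x z≢y r) y∉  = sole (sole-rename-other S r (y∉ ∘ quantF z≢y) z≢x z≢y)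
hidden-rename (inQ h) (other _ z≢y r) y∉     = inQ (hidden-rename h r (y∉ ∘ quantF z≢y))

hidden-root : ∀ {r} → HiddenRedex F → 𝓣 r → Base r F G → HiddenRedex G
hidden-root (inL h)       isA assoc  = inL (inL h)
hidden-root (inR (inL h)) isA assoc  = inL (inR h)
hidden-root (inR (inR h)) isA assoc  = inR h
hidden-root (inL (inL h)) isA assoc⁻ = inL h
hidden-root (inL (inR h)) isA assoc⁻ = inR (inL h)
hidden-root (inR h)       isA assoc⁻ = inR (inR h)
hidden-root (inL h)       isC comm   = inR h
hidden-root (inR h)       isC comm   = inL h
hidden-root {F = quant _ x (quant _ y _)} h isO swap with x ≟ y
... | yes refl = h
hidden-root (vacuous x∉)         isO swap | no x≢y = inQ (vacuous (x∉ ∘ quantF (x≢y ∘ sym)))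
hidden-root (sole (under _ S))   isO swap | no x≢y = inQ (sole S)
hidden-root (sole (here _ D))    isO swap | no x≢y = ⊥-elim (dual-quant-unsplittable D)
hidden-root (inQ (vacuous y∉))   isO swap | no x≢y = vacuous (quant-fresh y∉)
hidden-root (inQ (sole S))       isO swap | no x≢y = sole (under x≢y S)
hidden-root (inQ (inQ h))        isO swap | no x≢y = inQ (inQ h)
hidden-root (vacuous x∉)              isP↓ (pushP _)  = inL (vacuous (x∉ ∘ binL))
hidden-root (sole (left _ S _))       isP↓ (pushP _)  = inL (sole S)
hidden-root (sole (right _ _ S))      isP↓ (pushP x∉) = ⊥-elim (x∉ (sole-free S))
hidden-root (sole (here _ D))         isP↓ (pushP _)  = ⊥-elim (dual-bin-unsplittable refl D)
hidden-root (inQ (inL h))             isP↓ (pushP _)  = inL (inQ h)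
hidden-root (inQ (inR h))             isP↓ (pushP _)  = inR h
hidden-root (inL (vacuous x∉))        isP↑ (pullP x∉₂) = vacuous (bin-fresh x∉ x∉₂)
hidden-root (inL (sole S))            isP↑ (pullP x∉₂) = sole (left refl S x∉₂)
hidden-root (inL (inQ h))             isP↑ (pullP _)   = inQ (inL h)
hidden-root (inR h)                   isP↑ (pullP _)   = inQ (inR h)
hidden-root (vacuous x∉)  isN (rename y∉ r) = vacuous (x∉ ∘ rename-free-renamed⁻ r y∉)
hidden-root (sole S)      isN (rename y∉ r) = sole (sole-rename S r y∉)
hidden-root (inQ h)       isN (rename y∉ r) = inQ (hidden-rename h r y∉)

hidden-step : HiddenRedex F → Step 𝓣 F G → HiddenRedex G
hidden-step h             (root t s) = hidden-root h t s
hidden-step (inL h)       (inL s)    = inL (hidden-step h s)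
hidden-step (inL h)       (inR s)    = inL h
hidden-step (inR h)       (inL s)    = inR h
hidden-step (inR h)       (inR s)    = inR (hidden-step h s)
hidden-step (vacuous x∉)  (inQ s)    = vacuous (x∉ ∘ 𝓣-step-free⁻ s)
hidden-step (sole S)      (inQ s)    = sole (sole-step S s)
hidden-step (inQ h)       (inQ s)    = inQ (hidden-step h s)

hidden-equiv : Equiv 𝓣 F G → HiddenRedex G → HiddenRedex F
hidden-equiv ε            h = h
hidden-equiv (fwd s ◅ ss) h = hidden-step (hidden-equiv ss h) (𝓣-step-sym s)
hidden-equiv (bwd s ◅ ss) h = hidden-step (hidden-equiv ss h) s

-- Exposing a hidden redex modulo ACO

PSMReducible : Formula → Set
PSMReducible F = ∃₂ λ F' G → Equiv ACO F F' × Step PSM F' G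

psm-step-reducible : Step PSM F G → PSMReducible F
psm-step-reducible s = _ , _ , ε , s

reducible-equiv : Equiv ACO F F' → PSMReducible F' → PSMReducible F
reducible-equiv eq (F'' , G , eq' , s) = F'' , G , eq ◅◅ eq' , s

reducible-cong : (f : Formula → Formula) → (∀ {𝓡 F G} → Step 𝓡 F G → Step 𝓡 (f F) (f G)) →
                 PSMReducible F → PSMReducible (f F)
reducible-cong f step-f (F' , G , eq , s) = f F' , f G , gmap f step-f eq , step-f s

data Component (o : Op) (K : Formula) : Formula → Set where
  here  : Component o K K
  left  : Component o K F → Component o K (bin o F G)
  right : Component o K G → Component o K (bin o F G)

component-to-right : ∀ {K} → Component o K F → F ≡ K ⊎ ∃ λ F' → Equiv ACO F (bin o F' K)
component-to-right here = inj₁ refl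
component-to-right (left {G = G} k) with component-to-right k
... | inj₁ refl     = inj₂ (G , return (root isC comm))
... | inj₂ (F' , eq) = inj₂ (bin _ F' G , gmap (λ X → bin _ X G) inL eq ◅◅
                        fwd (root isA assoc⁻) ◅ fwd (inR (root isC comm)) ◅ fwd (root isA assoc) ◅ ε)
component-to-right (right {F = F} k) with component-to-right k
... | inj₁ refl     = inj₂ (F , ε)
... | inj₂ (G' , eq) = inj₂ (bin _ F G' , gmap (bin _ F) inR eq ◅◅ return (root isA assoc))

component-reducible : ∀ {K} → Component (pOp q) K F → ¬ Free z K → PSMReducible (quant q z F)
component-reducible k z∉ with component-to-right k
... | inj₁ refl      = psm-step-reducible (root isM (drop z∉))
... | inj₂ (_ , eq) = reducible-equiv (gmap (quant _ _) inQ eq) (psm-step-reducible (root isP↓ (pushP z∉)))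

UsesBoth : Colouring q F → Set
UsesBoth c = ∀ b → Uses b c

uses-both : ∀ b {c : Colouring q F} → Uses b c → Uses (not b) c → UsesBoth c
uses-both true  t f true  = t
uses-both true  t f false = f
uses-both false f t true  = t
uses-both false f t false = f

mutual
  bind-reducible : {c : Colouring q F} → UsesBoth (bind {z = z} c) → Proper (bind {z = z} c) →
                   PSMReducible (quant q z F)
  bind-reducible ub (bind {b = b} a m) with ub (not b)
  ... | under u with avoiding-component a m u
  ...   | inj₁ (_ , k , z∉) = component-reducible k z∉
  ...   | inj₂ red          = reducible-cong (quant _ _) inQ red

  avoiding-component : {c : Colouring q F} → Confined y b c → Proper c → Uses (not b) c →
                       (∃ λ K → Component (pOp q) K F × ¬ Free y K) ⊎ PSMReducible F
  avoiding-component {c = node refl _ _} (node a₁ _) (node m₁ _) (left u) with avoiding-component a₁ m₁ u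
  ... | inj₁ (K , k , y∉) = inj₁ (K , left k , y∉)
  ... | inj₂ red          = inj₂ (reducible-cong (λ X → bin _ X _) inL red)
  avoiding-component {c = node refl _ _} (node _ a₂) (node _ m₂) (right u) with avoiding-component a₂ m₂ u
  ... | inj₁ (K , k , y∉) = inj₁ (K , right k , y∉)
  ... | inj₂ red          = inj₂ (reducible-cong (bin _ _) inR red)
  avoiding-component {c = leaf _} (leaf same) _ leaf = inj₁ (_ , here , λ yF → not-¬ refl (sym (same yF)))
  avoiding-component {F = F} {y = y} {c = bind _} a m u with free? y F
  ... | no y∉  = inj₁ (F , here , y∉)
  ... | yes yF = inj₂ (bind-reducible (uses-both _ (confined-uses a yF) u) m)

dual-splittable-reducible : Splittable (flipQ q) F → PSMReducible (quant q x F)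
dual-splittable-reducible (split (leaf _) leaf () _)
dual-splittable-reducible {q} (split (node e _ _) _ _ _) with trans e (sym (sOp≡pOp∘flipQ q))
... | refl = psm-step-reducible (root isS↓ pushS)
dual-splittable-reducible (split (bind _) t f m) =
  reducible-cong (quant _ _) inQ (bind-reducible (uses-both true t f) m)

sole-reducible : SoleSplittable q x F → PSMReducible (quant q x F)
sole-reducible (left refl _ x∉G)  = psm-step-reducible (root isP↓ (pushP x∉G))
sole-reducible (right refl x∉F _) =
  reducible-equiv (return (inQ (root isC comm))) (psm-step-reducible (root isP↓ (pushP x∉F)))
sole-reducible (under _ S)        =
  reducible-equiv (return (root isO swap)) (reducible-cong (quant _ _) inQ (sole-reducible S))
sole-reducible (here _ D)         = dual-splittable-reducible D

hidden⇒reducible : HiddenRedex F → PSMReducible F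
hidden⇒reducible (vacuous x∉) = psm-step-reducible (root isM (drop x∉))
hidden⇒reducible (sole S)     = sole-reducible S
hidden⇒reducible (inL h)      = reducible-cong (λ X → bin _ X _) inL (hidden⇒reducible h)
hidden⇒reducible (inR h)      = reducible-cong (bin _ _) inR (hidden⇒reducible h)
hidden⇒reducible (inQ h)      = reducible-cong (quant _ _) inQ (hidden⇒reducible h)

theorem4p3 : (φ : Formula) →
    IsNormalFormQ (Equiv ACO) (Step PSM) φ →
    IsNormalFormQ (Equiv 𝓣) (Step SM) φ
theorem4p3 φ normal (_ , _ , _ , φ≈ψ , _ , ψ⟶) with hidden⇒reducible (hidden-equiv φ≈ψ (sm-step⇒hidden ψ⟶))
... | φ' , χ , φ≈φ' , φ'⟶χ = normal (χ , φ' , χ , φ≈φ' , ε , φ'⟶χ)
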